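{- Let $P$ be a range-overlapping $0-1$ matrix and let $k$ be a positive integer. Then for all positive integers $m,n$, $$ex(m,n,P) \le k\bigl(ex_k(m,P)+n\bigr).$$
   Context: A $0-1$ matrix $A$ contains a $0-1$ matrix $M$ if some submatrix of $A$ (obtained by selecting some rows and some columns, keeping their order) can be transformed into $M$ by changing some ones to zeroes; otherwise $A$ avoids $M$. $ex(m,n,P)$ is the maximum number of ones in an $m\times n$ $0-1$ matrix that avoids $P$. $ex_k(m,P)$ is the maximum number of columns in a $0-1$ matrix with $m$ rows that avoids $P$ and has at least $k$ ones in every column (possibly $\infty$). For each column of $P$, consider the segment (interval of row indices) from its topmost one to its bottommost one; $P$ is called range-overlapping if for every pair of columns of $P$ there is a horizontal line (row position) passing through the segments of both columns, i.e. the two intervals of row indices intersect. -}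

module Defs where

open import Data.Nat using (ℕ; zero; suc; _+_; _≤_)
open import Data.Fin using (Fin; zero; suc; _<_)
open import Data.Bool using (Bool; true; false)
open import Data.Product using (Σ; ∃; _×_; _,_)
open import Relation.Binary.PropositionalEquality using (_≡_; _≢_)
open import Relation.Nullary using (¬_)

Mat : ℕ → ℕ → Set
Mat m n = Fin m → Fin n → Bool

countTrue : (n : ℕ) → (Fin n → Bool) → ℕ
countTrue zero    v = 0
countTrue (suc n) v with v zero
... | true  = suc (countTrue n (λ j → v (suc j)))
... | false = countTrue n (λ j → v (suc j))

ones : {m n : ℕ} → Mat m n → ℕ
ones {zero}  {n} A = 0
ones {suc m} {n} A = countTrue n (A zero) + ones {m} {n} (λ i → A (suc i))

colOnes : {m n : ℕ} → Mat m n → Fin n → ℕ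
colOnes {m} A j = countTrue m (λ i → A i j)

StrictlyIncreasing : {a b : ℕ} → (Fin a → Fin b) → Set
StrictlyIncreasing f = ∀ i j → i < j → f i < f j

-- A contains P: select rows f and columns g (keeping order) such that
-- every one of P sits on a one of A (remaining ones may be turned to zeroes).
Contains : {m n r c : ℕ} → Mat m n → Mat r c → Set
Contains {m} {n} {r} {c} A P =
  Σ (Fin r → Fin m) λ f → Σ (Fin c → Fin n) λ g →
    StrictlyIncreasing f × StrictlyIncreasing g ×
    (∀ i j → P i j ≡ true → A (f i) (g j) ≡ true)

Avoids : {m n r c : ℕ} → Mat m n → Mat r c → Set
Avoids A P = ¬ Contains A P

-- row i lies in the segment of column j (from its topmost to its bottommost one)
InSegment : {r c : ℕ} → Mat r c → Fin c → Fin r → Set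
InSegment {r} P j i =
  Σ (Fin r) λ a → Σ (Fin r) λ b →
    (P a j ≡ true) × (P b j ≡ true) × (Data.Fin._≤_ a i) × (Data.Fin._≤_ i b)

RangeOverlapping : {r c : ℕ} → Mat r c → Set
RangeOverlapping {r} {c} P =
  ∀ (j j' : Fin c) → j ≢ j' → Σ (Fin r) λ i → InSegment P j i × InSegment P j' i

IsEx : (m n : ℕ) {r c : ℕ} → Mat r c → ℕ → Set
IsEx m n P e =
  (Σ (Mat m n) λ A → Avoids A P × ones A ≡ e) ×
  (∀ (A : Mat m n) → Avoids A P → ones A ≤ e)

ColsAtLeast : ℕ → {m c : ℕ} → Mat m c → Set
ColsAtLeast k {m} {c} A = ∀ (j : Fin c) → k ≤ colOnes A j

IsExk : (k m : ℕ) {r c : ℕ} → Mat r c → ℕ → Set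
IsExk k m P e =
  (Σ ℕ λ c → Σ (Mat m c) λ A → Avoids A P × ColsAtLeast k A × c ≡ e) ×
  (∀ (c : ℕ) (A : Mat m c) → Avoids A P → ColsAtLeast k A → c ≤ e)

module Submission where

-- Cut every column of A, from left to right, into blocks of k
-- ones: while the current column still has at least k ones, its topmost k ones
-- become a new column of an auxiliary matrix B and are removed from A; once
-- fewer than k ones remain they are discarded.  Each column of A loses fewer
-- than k ones, so  ones A ≤ k · (#columns of B + n).  Every column of B has at
-- least k ones, and B avoids P: a copy of P in B yields a copy of P in A,
-- because two columns of the copy never come from the same column of A -- the
-- pieces of one column of A occupy vertically ordered, disjoint row ranges,
-- whereas the segments of any two columns of a range-overlapping P share a row.
-- Hence #columns of B ≤ ex_k(m,P), which gives the theorem.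

open import Defs
open import Data.Nat using (ℕ; zero; suc; z≤n; s≤s; _+_; _*_; _≤_; _<_)
open import Data.Nat.Properties
open import Algebra.Properties.CommutativeSemigroup +-commutativeSemigroup using (interchange)
open import Data.Fin as Fin using (Fin)
import Data.Fin.Properties as Finₚ
open import Data.Bool using (Bool; true; false; if_then_else_)
open import Data.Product using (_,_)
open import Relation.Nullary using (yes; no; contradiction)
open import Relation.Binary.PropositionalEquality

bit : Bool → ℕ
bit true  = 1
bit false = 0

countTrue-suc : ∀ n (v : Fin (suc n) → Bool) →
  countTrue (suc n) v ≡ bit (v Fin.zero) + countTrue n (λ j → v (Fin.suc j))
countTrue-suc n v with v Fin.zero
... | true  = refl
... | false = refl

countTrue-false : ∀ n → countTrue n (λ _ → false) ≡ 0
countTrue-false zero    = refl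
countTrue-false (suc n) = countTrue-false n

ones-noColumns : ∀ {m} (A : Mat m 0) → ones A ≡ 0
ones-noColumns {zero}  A = refl
ones-noColumns {suc m} A = ones-noColumns (λ i → A (Fin.suc i))

firstColumn : ∀ {m n} → Mat m (suc n) → Fin m → Bool
firstColumn A i = A i Fin.zero

otherColumns : ∀ {m n} → Mat m (suc n) → Mat m n
otherColumns A i j = A i (Fin.suc j)

prependColumn : ∀ {m n} → (Fin m → Bool) → Mat m n → Mat m (suc n)
prependColumn v A i Fin.zero    = v i
prependColumn v A i (Fin.suc j) = A i j

-- The ones of a matrix are those of its first column plus those of the rest
-- (the definition of  ones  counts row by row).
ones-firstColumn : ∀ {m n} (A : Mat m (suc n)) →
  ones A ≡ countTrue m (firstColumn A) + ones (otherColumns A)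
ones-firstColumn {zero}      A = refl
ones-firstColumn {suc m} {n} A = begin
  countTrue (suc n) (A Fin.zero) + ones (λ i → A (Fin.suc i))
    ≡⟨ cong₂ _+_ (countTrue-suc n (A Fin.zero)) (ones-firstColumn (λ i → A (Fin.suc i))) ⟩
  (a + b) + (c + d)  ≡⟨ interchange a b c d ⟩
  (a + c) + (b + d)  ≡⟨ cong (_+ (b + d)) (sym (countTrue-suc m (firstColumn A))) ⟩
  countTrue (suc m) (firstColumn A) + (b + d) ∎
  where
  open ≡-Reasoning
  a = bit (A Fin.zero Fin.zero)
  b = countTrue n (λ j → A Fin.zero (Fin.suc j))
  c = countTrue m (λ i → A (Fin.suc i) Fin.zero)
  d = ones (λ i j → A (Fin.suc i) (Fin.suc j))

topOnes : ∀ {m} → ℕ → (Fin m → Bool) → Fin m → Bool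
topOnes zero    v i           = false
topOnes (suc k) v Fin.zero    = v Fin.zero
topOnes (suc k) v (Fin.suc i) =
  topOnes (if v Fin.zero then k else suc k) (λ j → v (Fin.suc j)) i

belowTop : ∀ {m} → ℕ → (Fin m → Bool) → Fin m → Bool
belowTop zero    v i           = v i
belowTop (suc k) v Fin.zero    = false
belowTop (suc k) v (Fin.suc i) =
  belowTop (if v Fin.zero then k else suc k) (λ j → v (Fin.suc j)) i

topOnes⊆ : ∀ {m} k (v : Fin m → Bool) i → topOnes k v i ≡ true → v i ≡ true
topOnes⊆ zero    v i           ()
topOnes⊆ (suc k) v Fin.zero    p = p
topOnes⊆ (suc k) v (Fin.suc i) p with v Fin.zero
... | true  = topOnes⊆ k       (λ j → v (Fin.suc j)) i p
... | false = topOnes⊆ (suc k) (λ j → v (Fin.suc j)) i p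

belowTop⊆ : ∀ {m} k (v : Fin m → Bool) i → belowTop k v i ≡ true → v i ≡ true
belowTop⊆ zero    v i           p = p
belowTop⊆ (suc k) v Fin.zero    ()
belowTop⊆ (suc k) v (Fin.suc i) p with v Fin.zero
... | true  = belowTop⊆ k       (λ j → v (Fin.suc j)) i p
... | false = belowTop⊆ (suc k) (λ j → v (Fin.suc j)) i p

topOnes-above-belowTop : ∀ {m} k (v : Fin m → Bool) a b →
  topOnes k v a ≡ true → belowTop k v b ≡ true → a Fin.< b
topOnes-above-belowTop zero    v a           b           ()
topOnes-above-belowTop (suc k) v Fin.zero    Fin.zero    p ()
topOnes-above-belowTop (suc k) v Fin.zero    (Fin.suc b) p q = s≤s z≤n
topOnes-above-belowTop (suc k) v (Fin.suc a) Fin.zero    p ()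
topOnes-above-belowTop (suc k) v (Fin.suc a) (Fin.suc b) p q with v Fin.zero
... | true  = s≤s (topOnes-above-belowTop k       (λ j → v (Fin.suc j)) a b p q)
... | false = s≤s (topOnes-above-belowTop (suc k) (λ j → v (Fin.suc j)) a b p q)

countTrue-split : ∀ m k (v : Fin m → Bool) →
  countTrue m v ≡ countTrue m (topOnes k v) + countTrue m (belowTop k v)
countTrue-split m       zero    v rewrite countTrue-false m = refl
countTrue-split zero    (suc k) v = refl
countTrue-split (suc m) (suc k) v
  rewrite countTrue-suc m v | countTrue-suc m (topOnes (suc k) v)
        | countTrue-suc m (belowTop (suc k) v) with v Fin.zero
... | true  = cong suc (countTrue-split m k (λ j → v (Fin.suc j)))
... | false = countTrue-split m (suc k) (λ j → v (Fin.suc j))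

countTrue-topOnes≤ : ∀ m k (v : Fin m → Bool) → countTrue m (topOnes k v) ≤ k
countTrue-topOnes≤ m       zero    v rewrite countTrue-false m = z≤n
countTrue-topOnes≤ zero    (suc k) v = z≤n
countTrue-topOnes≤ (suc m) (suc k) v rewrite countTrue-suc m (topOnes (suc k) v) with v Fin.zero
... | true  = s≤s (countTrue-topOnes≤ m k (λ j → v (Fin.suc j)))
... | false = countTrue-topOnes≤ m (suc k) (λ j → v (Fin.suc j))

countTrue-topOnes≥ : ∀ m k (v : Fin m → Bool) → k ≤ countTrue m v → k ≤ countTrue m (topOnes k v)
countTrue-topOnes≥ m       zero    v p  = z≤n
countTrue-topOnes≥ zero    (suc k) v ()
countTrue-topOnes≥ (suc m) (suc k) v p
  rewrite countTrue-suc m (topOnes (suc k) v) | countTrue-suc m v with v Fin.zero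
... | true  = s≤s (countTrue-topOnes≥ m k (λ j → v (Fin.suc j)) (≤-pred p))
... | false = countTrue-topOnes≥ m (suc k) (λ j → v (Fin.suc j)) p

record Refinement (k : ℕ) {m n : ℕ} (A : Mat m n) : Set where
  field
    width           : ℕ
    pieces          : Mat m width
    origin          : Fin width → Fin n
    full            : ColsAtLeast k pieces
    origin-monotone : ∀ j j' → j Fin.< j' → origin j Fin.≤ origin j'
    within          : ∀ i j → pieces i j ≡ true → A i (origin j) ≡ true
    stacked         : ∀ j j' → j Fin.< j' → origin j ≡ origin j' →
                      ∀ a b → pieces a j ≡ true → pieces b j' ≡ true → a Fin.< b
    lossBound       : ones A ≤ k * (width + n)

open Refinement

noColumns-refinement : ∀ {k m} (A : Mat m 0) → Refinement k A
noColumns-refinement {k} A = record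
  { width = 0 ; pieces = λ _ () ; origin = λ () ; full = λ ()
  ; origin-monotone = λ () ; within = λ _ () ; stacked = λ ()
  ; lossBound = ≤-reflexive (trans (ones-noColumns A) (sym (*-zeroʳ k))) }

trimmed : ∀ {m n} → ℕ → Mat m (suc n) → Mat m (suc n)
trimmed k A = prependColumn (belowTop k (firstColumn A)) (otherColumns A)

ones-trimmed : ∀ {m n} k (A : Mat m (suc n)) →
  ones A ≡ countTrue m (topOnes k (firstColumn A)) + ones (trimmed k A)
ones-trimmed {m} k A = begin
  ones A                                        ≡⟨ ones-firstColumn A ⟩
  countTrue m (firstColumn A) + ones rest       ≡⟨ cong (_+ ones rest) (countTrue-split m k (firstColumn A)) ⟩
  (top + below) + ones rest                     ≡⟨ +-assoc top below (ones rest) ⟩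
  top + (below + ones rest)                     ≡⟨ cong (top +_) (sym (ones-firstColumn (trimmed k A))) ⟩
  top + ones (trimmed k A)                      ∎
  where
  open ≡-Reasoning
  rest  = otherColumns A
  top   = countTrue m (topOnes k (firstColumn A))
  below = countTrue m (belowTop k (firstColumn A))

refine-split : ∀ {k m n} (A : Mat m (suc n)) → k ≤ colOnes A Fin.zero →
  Refinement k (trimmed k A) → Refinement k A
refine-split {k} {m} {n} A enough R = record
  { width = suc (width R) ; pieces = prependColumn top (pieces R) ; origin = origin′
  ; full = full′ ; origin-monotone = monotone′ ; within = within′ ; stacked = stacked′
  ; lossBound = loss′ }
  where
  top = topOnes k (firstColumn A)
  origin′ : Fin (suc (width R)) → Fin (suc n)
  origin′ Fin.zero    = Fin.zero
  origin′ (Fin.suc j) = origin R j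
  trimmed⊆ : ∀ i j → trimmed k A i j ≡ true → A i j ≡ true
  trimmed⊆ i Fin.zero    p = belowTop⊆ k (firstColumn A) i p
  trimmed⊆ i (Fin.suc j) p = p
  full′ : ColsAtLeast k (prependColumn top (pieces R))
  full′ Fin.zero    = countTrue-topOnes≥ m k (firstColumn A) enough
  full′ (Fin.suc j) = full R j
  monotone′ : ∀ j j' → j Fin.< j' → origin′ j Fin.≤ origin′ j'
  monotone′ Fin.zero    j'           _       = z≤n
  monotone′ (Fin.suc j) (Fin.suc j') (s≤s p) = origin-monotone R j j' p
  within′ : ∀ i j → prependColumn top (pieces R) i j ≡ true → A i (origin′ j) ≡ true
  within′ i Fin.zero    p = topOnes⊆ k (firstColumn A) i p
  within′ i (Fin.suc j) p = trimmed⊆ i (origin R j) (within R i j p)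
  stacked′ : ∀ j j' → j Fin.< j' → origin′ j ≡ origin′ j' → ∀ a b →
    prependColumn top (pieces R) a j ≡ true → prependColumn top (pieces R) b j' ≡ true → a Fin.< b
  stacked′ Fin.zero (Fin.suc j') _ same a b p q =
    topOnes-above-belowTop k (firstColumn A) a b p
      (subst (λ o → trimmed k A b o ≡ true) (sym same) (within R b j' q))
  stacked′ (Fin.suc j) (Fin.suc j') (s≤s lt) same = stacked R j j' lt same
  loss′ : ones A ≤ k * (suc (width R) + suc n)
  loss′ = begin
    ones A                                          ≡⟨ ones-trimmed k A ⟩
    countTrue m top + ones (trimmed k A)            ≤⟨ +-mono-≤ (countTrue-topOnes≤ m k (firstColumn A)) (lossBound R) ⟩
    k + k * (width R + suc n)                       ≡⟨ sym (*-suc k _) ⟩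
    k * (suc (width R) + suc n)                     ∎
    where open ≤-Reasoning

refine-drop : ∀ {k m n} (A : Mat m (suc n)) → colOnes A Fin.zero < k →
  Refinement k (otherColumns A) → Refinement k A
refine-drop {k} {m} {n} A few R = record
  { width = width R ; pieces = pieces R ; origin = λ j → Fin.suc (origin R j)
  ; full = full R ; origin-monotone = λ j j' p → s≤s (origin-monotone R j j' p)
  ; within = within R ; stacked = λ j j' lt same → stacked R j j' lt (Finₚ.suc-injective same)
  ; lossBound = loss′ }
  where
  loss′ : ones A ≤ k * (width R + suc n)
  loss′ = begin
    ones A                                                ≡⟨ ones-firstColumn A ⟩
    countTrue m (firstColumn A) + ones (otherColumns A)   ≤⟨ +-mono-≤ (<⇒≤ few) (lossBound R) ⟩
    k + k * (width R + n)                                 ≡⟨ sym (*-suc k _) ⟩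
    k * suc (width R + n)                                 ≡⟨ cong (k *_) (sym (+-suc (width R) n)) ⟩
    k * (width R + suc n)                                 ∎
    where open ≤-Reasoning

ones-trimmed< : ∀ {k m n} (A : Mat m (suc n)) → 0 < k → k ≤ colOnes A Fin.zero →
  ones (trimmed k A) < ones A
ones-trimmed< {k} {m} A k>0 enough = begin-strict
  ones (trimmed k A)                                            <⟨ m<n+m _ topCount>0 ⟩
  countTrue m (topOnes k (firstColumn A)) + ones (trimmed k A)  ≡⟨ sym (ones-trimmed k A) ⟩
  ones A                                                        ∎
  where
  open ≤-Reasoning
  topCount>0 : 0 < countTrue m (topOnes k (firstColumn A))
  topCount>0 = ≤-trans k>0 (countTrue-topOnes≥ m k (firstColumn A) enough)

ones-otherColumns≤ : ∀ {m n} (A : Mat m (suc n)) → ones (otherColumns A) ≤ ones A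
ones-otherColumns≤ {m} A = begin
  ones (otherColumns A)                                  ≤⟨ m≤n+m _ (countTrue m (firstColumn A)) ⟩
  countTrue m (firstColumn A) + ones (otherColumns A)    ≡⟨ sym (ones-firstColumn A) ⟩
  ones A                                                 ∎
  where open ≤-Reasoning

-- Every matrix has a k-refinement.  Trimming removes k > 0 ones and dropping
-- removes a column, so  ones A + n  bounds the number of steps (the fuel).
refine : ∀ {k} → 0 < k → ∀ fuel {m n} (A : Mat m n) → ones A + n ≤ fuel → Refinement k A
refine     k>0 fuel       {n = zero}  A _     = noColumns-refinement A
refine     k>0 zero       {n = suc n} A bound =
  contradiction (≤-trans (m≤n+m (suc n) (ones A)) bound) λ ()
refine {k} k>0 (suc fuel) {n = suc n} A bound with k ≤? colOnes A Fin.zero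
... | yes enough = refine-split A enough (refine k>0 fuel (trimmed k A) (≤-pred
  (≤-trans (+-monoˡ-< (suc n) (ones-trimmed< A k>0 enough)) bound)))
... | no  few    = refine-drop A (≰⇒> few) (refine k>0 fuel (otherColumns A) (≤-pred
  (≤-trans (≤-reflexive (sym (+-suc (ones (otherColumns A)) n)))
           (≤-trans (+-monoˡ-≤ (suc n) (ones-otherColumns≤ A)) bound))))

strictlyIncreasing⇒monotone : ∀ {a b} {f : Fin a → Fin b} → StrictlyIncreasing f →
  ∀ {i j} → i Fin.≤ j → f i Fin.≤ f j
strictlyIncreasing⇒monotone inc {i} {j} i≤j with i Finₚ.≟ j
... | yes refl = ≤-refl
... | no  i≢j  = <⇒≤ (inc i j (Finₚ.≤∧≢⇒< i≤j i≢j))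

-- In a copy of a range-overlapping P inside the pieces of a refinement, distinct
-- columns of P come from distinct columns of A: take a row shared by their
-- segments; the bottom one of the left column lies weakly below the top one of
-- the right column, while stacking puts it strictly above.
origins-distinct : ∀ {k m n r c} {A : Mat m n} {P : Mat r c} → RangeOverlapping P →
  (R : Refinement k A) (f : Fin r → Fin m) (g : Fin c → Fin (width R)) →
  StrictlyIncreasing f → StrictlyIncreasing g →
  (∀ i j → P i j ≡ true → pieces R (f i) (g j) ≡ true) →
  ∀ j j' → j Fin.< j' → origin R (g j) ≢ origin R (g j')
origins-distinct rangeOverlapping R f g f-inc g-inc embeds j j' j<j' same
  with rangeOverlapping j j' (Finₚ.<⇒≢ j<j')
... | i , (_ , bottom , _ , P-bottom , _ , i≤bottom) , (top , _ , P-top , _ , top≤i , _) =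
  <⇒≱ (stacked R (g j) (g j') (g-inc j j' j<j') same (f bottom) (f top)
         (embeds bottom j P-bottom) (embeds top j' P-top))
      (strictlyIncreasing⇒monotone f-inc (≤-trans top≤i i≤bottom))

refinement-reflects : ∀ {k m n r c} {A : Mat m n} {P : Mat r c} → RangeOverlapping P →
  (R : Refinement k A) → Contains (pieces R) P → Contains A P
refinement-reflects rangeOverlapping R (f , g , f-inc , g-inc , embeds) =
  f , (λ j → origin R (g j)) , f-inc , origins-increasing ,
  λ i j p → within R (f i) (g j) (embeds i j p)
  where
  origins-increasing : StrictlyIncreasing (λ j → origin R (g j))
  origins-increasing j j' j<j' =
    Finₚ.≤∧≢⇒< (origin-monotone R (g j) (g j') (g-inc j j' j<j'))
          (origins-distinct rangeOverlapping R f g f-inc g-inc embeds j j' j<j')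

mainTheorem1 : {r c : ℕ} (P : Mat r c) → RangeOverlapping P →
    (k : ℕ) → 0 < k → (m n : ℕ) → 0 < m → 0 < n →
    (e ek : ℕ) → IsEx m n P e → IsExk k m P ek →
    e ≤ k * (ek + n)
mainTheorem1 P rangeOverlapping k k>0 m n _ _ e ek ((A , A-avoids , onesA≡e) , _) (_ , exk-max) = begin
  e                  ≡⟨ sym onesA≡e ⟩
  ones A             ≤⟨ lossBound R ⟩
  k * (width R + n)  ≤⟨ *-monoʳ-≤ k (+-monoˡ-≤ n width≤ek) ⟩
  k * (ek + n)       ∎
  where
  open ≤-Reasoning
  R : Refinement k A
  R = refine k>0 (ones A + n) A ≤-refl
  width≤ek : width R ≤ ek
  width≤ek = exk-max (width R) (pieces R)
    (λ B-contains → A-avoids (refinement-reflects rangeOverlapping R B-contains)) (full R)
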